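{- Let $s\ge2$ and let $\mu=(\mu_1,\dots,\mu_s)\vdash n$ with $\mu_{s-1}>\mu_s$. Then $$f(\mu^{\uparrow s})-f(\mu)=(2\mu_s+1)f(\mu^{\uparrow s}-\hat{1})-2\mu_s f(\mu-\hat{1}).$$
   Context: Partitions are non-increasing sequences of positive integers; $\lambda\vdash n$ means the parts sum to $n$. For $\lambda=(\lambda_1,\dots,\lambda_r)$: $\lambda\setminus\lambda_r:=(\lambda_1,\dots,\lambda_{r-1})$; for $1\le k\le\lambda_r$, $\lambda-\hat{k}:=(\lambda_1-k,\dots,\lambda_r-k)$; zero parts are deleted and the all-zero sequence is identified with $(0)$. For a partition $\mu$ of length $s$ with $\mu_{i-1}>\mu_i$, $\mu^{\uparrow i}$ is the partition obtained by replacing $\mu_i$ by $\mu_i+1$. Define $d_0=1$, $d_1=0$, $d_n=2(n-1)(d_{n-1}+d_{n-2})$ for $n\ge2$. Define $f$ on partitions recursively: $f((0))=1$; $f((n))=d_n$ for $n\ge1$; and for $\lambda=(\lambda_1,\dots,\lambda_r)$ with $r\ge2$, $f(\lambda)=f(\lambda\setminus\lambda_r)+\sum_{k=1}^{\lambda_r}\binom{\lambda_r}{k}(2k-1)!!\,f(\lambda\setminus\lambda_r-\hat{k})$. -}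

module Defs where

open import Data.Nat using (ℕ; zero; suc; _+_; _*_; _∸_; _≥_; _<_)
open import Data.Nat.Combinatorics using (_C_)
open import Data.List using (List; []; _∷_; map; length; reverse)
open import Data.Nat.ListAction using (sum)
open import Relation.Binary.PropositionalEquality using (_≡_)
open import Data.List.Relation.Unary.All using (All)
open import Data.List.Relation.Unary.Linked using (Linked)
open import Data.Product using (_×_)

-- A partition: a non-increasing list of positive integers.
-- The empty list [] represents the partition (0).
IsPartition : List ℕ → Set
IsPartition λ′ = Linked _≥_ λ′ × All (0 <_) λ′

_⊢_ : List ℕ → ℕ → Set
λ′ ⊢ n = IsPartition λ′ × sum λ′ ≡ n

-- 1-indexed part λ_i (0 if out of range)
part : List ℕ → ℕ → ℕ
part [] _ = 0
part (x ∷ xs) zero = 0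
part (x ∷ xs) (suc zero) = x
part (x ∷ xs) (suc (suc i)) = part xs (suc i)

-- μ^{↑i}: replace the i-th part (1-indexed) by itself + 1
raise : ℕ → List ℕ → List ℕ
raise _ [] = []
raise zero xs = xs
raise (suc zero) (x ∷ xs) = suc x ∷ xs
raise (suc (suc i)) (x ∷ xs) = x ∷ raise (suc i) xs

dropZeros : List ℕ → List ℕ
dropZeros [] = []
dropZeros (zero ∷ xs) = dropZeros xs
dropZeros (suc x ∷ xs) = suc x ∷ dropZeros xs

-- λ - k̂ : subtract k from every part, delete zeros (all-zero ↦ [] = (0))
minusHat : List ℕ → ℕ → List ℕ
minusHat λ′ k = dropZeros (map (_∸ k) λ′)

d : ℕ → ℕ
d zero = 1
d (suc zero) = 0
d (suc (suc n)) = 2 * suc n * (d (suc n) + d n)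

-- (2k-1)!!, with (-1)!! = 1
oddFact : ℕ → ℕ
oddFact zero = 1
oddFact (suc k) = (2 * k + 1) * oddFact k

sum1to : ℕ → (ℕ → ℕ) → ℕ
sum1to zero g = 0
sum1to (suc m) g = sum1to m g + g (suc m)

-- f on the REVERSED list (last part first), with fuel bounding the recursion depth
fRev : ℕ → List ℕ → ℕ
fRev _ [] = 1
fRev _ (n ∷ []) = d n
fRev zero (m ∷ x ∷ xs) = 0   -- unreachable with enough fuel
fRev (suc fuel) (m ∷ x ∷ xs) =
  fRev fuel (x ∷ xs)
  + sum1to m (λ k → (m C k) * oddFact k * fRev fuel (minusHat (x ∷ xs) k))

f : List ℕ → ℕ
f λ′ = fRev (length λ′) (reverse λ′)

-- Write g(k) = f(ν − k̂), where ν = μ \ μₛ. Unfolding the recursion of f at the last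
-- part writes f(μ) and f(μ↑) as f(ν) plus Σ_{k ≥ 1} w(μₛ, k) g(k), resp. Σ_{k ≥ 1} w(μₛ + 1, k) g(k),
-- with weights w(a, k) = C(a, k) (2k − 1)!!. Since μₛ₋₁ > μₛ ≥ 1, the part μₛ₋₁ survives in
-- μ − 1̂, so the same unfolding gives f(μ − 1̂) = Σ_{k ≥ 0} w(μₛ − 1, k) g(k + 1) and
-- f(μ↑ − 1̂) = Σ_{k ≥ 0} w(μₛ, k) g(k + 1). After f(ν) cancels, the theorem compares the
-- coefficients of each g(k), which reduces to (p + 1) C(p, i) = (p + 1 − i) C(p + 1, i).
module Submission where

open import Defs
open import Data.Nat using (ℕ; zero; suc; pred; _+_; _∸_; _≤_; _<_; _>_; z≤n; s≤s) renaming (_*_ to infixl 7 _·_)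
import Data.Nat.Properties as ℕₚ
open import Data.Nat.Combinatorics using (_C_; nCk+nC[k+1]≡[n+1]C[k+1]; nC1≡n; k>n⇒nCk≡0)
open import Data.Nat.Tactic.RingSolver using (solve-∀)
open import Data.Integer using (+_; _-_; _*_; _⊖_)
import Data.Integer.Properties as ℤₚ
open import Data.List using (List; []; _∷_; _++_; _∷ʳ_; length; map; reverse; initLast; _∷ʳ′_)
import Data.List.Properties as Listₚ
open import Data.List.Relation.Unary.All.Properties using (∷ʳ⁻)
open import Data.Product using (_,_; proj₂; ∃-syntax)
open import Function using (_∘_)
open import Relation.Binary.PropositionalEquality using (_≡_; refl; sym; trans; cong; cong₂; subst; module ≡-Reasoning)
open ≡-Reasoning

[n+1]C[k+1]≡nCk+nC[k+1] : ∀ n k → suc n C suc k ≡ n C k + n C suc k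
[n+1]C[k+1]≡nCk+nC[k+1] n k = sym (nCk+nC[k+1]≡[n+1]C[k+1] n k)

[k+1]*[n+1]C[k+1]≡[n+1]*nCk : ∀ n k → suc k · (suc n C suc k) ≡ suc n · (n C k)
[k+1]*[n+1]C[k+1]≡[n+1]*nCk zero zero = refl
[k+1]*[n+1]C[k+1]≡[n+1]*nCk zero (suc k) = ℕₚ.*-zeroʳ (2 + k)
[k+1]*[n+1]C[k+1]≡[n+1]*nCk (suc n) zero =
  trans (ℕₚ.*-identityˡ _) (trans (nC1≡n (2 + n)) (sym (ℕₚ.*-identityʳ _)))
[k+1]*[n+1]C[k+1]≡[n+1]*nCk (suc n) (suc k) = begin
  (2 + k) · (suc (suc n) C suc (suc k))  ≡⟨ cong ((2 + k) ·_) ([n+1]C[k+1]≡nCk+nC[k+1] (suc n) (suc k)) ⟩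
  (2 + k) · (A + B)                      ≡⟨ split k A B ⟩
  A + ((1 + k) · A + (2 + k) · B)        ≡⟨ cong (λ z → A + z) (cong₂ _+_ ([k+1]*[n+1]C[k+1]≡[n+1]*nCk n k)
                                                                    ([k+1]*[n+1]C[k+1]≡[n+1]*nCk n (suc k))) ⟩
  A + ((1 + n) · P + (1 + n) · Q)        ≡⟨ cong (λ z → A + z) (sym (ℕₚ.*-distribˡ-+ (1 + n) P Q)) ⟩
  A + (1 + n) · (P + Q)                  ≡⟨ cong (λ z → A + (1 + n) · z) (sym ([n+1]C[k+1]≡nCk+nC[k+1] n k)) ⟩
  A + (1 + n) · A                        ≡⟨⟩
  (2 + n) · A                            ∎
  where
  A = suc n C suc k
  B = suc n C suc (suc k)
  P = n C k
  Q = n C suc k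
  split : ∀ k A B → (2 + k) · (A + B) ≡ A + ((1 + k) · A + (2 + k) · B)
  split = solve-∀

-- (n + 1) C(n, i) = (n + 1 − i) C(n + 1, i), written without subtraction.
i*[n+1]Ci+[n+1]*nCi≡[n+1]*[n+1]Ci : ∀ n i → i · (suc n C i) + suc n · (n C i) ≡ suc n · (suc n C i)
i*[n+1]Ci+[n+1]*nCi≡[n+1]*[n+1]Ci n zero = refl
i*[n+1]Ci+[n+1]*nCi≡[n+1]*[n+1]Ci n (suc i) = begin
  suc i · (suc n C suc i) + suc n · (n C suc i)  ≡⟨ cong (_+ suc n · (n C suc i)) ([k+1]*[n+1]C[k+1]≡[n+1]*nCk n i) ⟩
  suc n · (n C i) + suc n · (n C suc i)          ≡⟨ sym (ℕₚ.*-distribˡ-+ (suc n) (n C i) (n C suc i)) ⟩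
  suc n · (n C i + n C suc i)                    ≡⟨ cong (suc n ·_) (sym ([n+1]C[k+1]≡nCk+nC[k+1] n i)) ⟩
  suc n · (suc n C suc i)                        ∎

weight : ℕ → ℕ → ℕ
weight a k = (a C k) · oddFact k

weight-step : ∀ p i →
  weight (2 + p) (suc i) + 2 · suc p · weight p i ≡ weight (suc p) (suc i) + (2 · suc p + 1) · weight (suc p) i
weight-step p i = begin
  (suc (suc p) C suc i) · (t · O) + 2 · suc p · (B · O)  ≡⟨ cong (λ z → z · (t · O) + 2 · suc p · (B · O))
                                                              ([n+1]C[k+1]≡nCk+nC[k+1] (suc p) i) ⟩
  (A + A′) · (t · O) + 2 · suc p · (B · O)               ≡⟨ regroup A A′ B O i p ⟩
  A′ · (t · O) + O · (A + 2 · (i · A + suc p · B))       ≡⟨ cong (λ z → A′ · (t · O) + O · (A + 2 · z))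
                                                              (i*[n+1]Ci+[n+1]*nCi≡[n+1]*[n+1]Ci p i) ⟩
  A′ · (t · O) + O · (A + 2 · (suc p · A))               ≡⟨ cong (λ z → A′ · (t · O) + z) (collect A O p) ⟩
  A′ · (t · O) + (2 · suc p + 1) · (A · O)               ∎
  where
  A = suc p C i
  A′ = suc p C suc i
  B = p C i
  O = oddFact i
  t = 2 · i + 1
  regroup : ∀ A A′ B O i p →
    (A + A′) · ((2 · i + 1) · O) + 2 · (1 + p) · (B · O)
    ≡ A′ · ((2 · i + 1) · O) + O · (A + 2 · (i · A + (1 + p) · B))
  regroup = solve-∀
  collect : ∀ A O p → O · (A + 2 · ((1 + p) · A)) ≡ (2 · (1 + p) + 1) · (A · O)
  collect = solve-∀

sum1to-cong : ∀ n {F G : ℕ → ℕ} → (∀ k → F (suc k) ≡ G (suc k)) → sum1to n F ≡ sum1to n G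
sum1to-cong zero    eq = refl
sum1to-cong (suc n) eq = cong₂ _+_ (sum1to-cong n eq) (eq n)

sum1to-linear : ∀ n c (F G : ℕ → ℕ) → sum1to n F + c · sum1to n G ≡ sum1to n (λ k → F k + c · G k)
sum1to-linear zero    c F G = ℕₚ.*-zeroʳ c
sum1to-linear (suc n) c F G =
  trans (interchange (sum1to n F) (F (suc n)) c (sum1to n G) (G (suc n)))
        (cong (_+ (F (suc n) + c · G (suc n))) (sum1to-linear n c F G))
  where
  interchange : ∀ a b c x y → (a + b) + c · (x + y) ≡ (a + c · x) + (b + c · y)
  interchange = solve-∀

sum1to-shift : ∀ n (h : ℕ → ℕ) → sum1to (suc n) h ≡ h 1 + sum1to n (h ∘ suc)
sum1to-shift zero    h = ℕₚ.+-comm 0 (h 1)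
sum1to-shift (suc n) h = trans (cong (_+ h (2 + n)) (sum1to-shift n h)) (ℕₚ.+-assoc (h 1) _ _)

sum1to-drop-last : ∀ n (h : ℕ → ℕ) → h (suc n) ≡ 0 → sum1to (suc n) h ≡ sum1to n h
sum1to-drop-last n h eq = trans (cong (λ z → sum1to n h + z) eq) (ℕₚ.+-identityʳ _)

weightedSum : ℕ → (ℕ → ℕ) → ℕ
weightedSum a g = sum1to a (λ k → weight a k · g k)

-- The sum from k = 0, re-indexed to start at 1 so that it can be compared termwise.
weightedSum-shift : ∀ a g → g 1 + weightedSum a (g ∘ suc) ≡ sum1to (suc a) (λ k → weight a (pred k) · g k)
weightedSum-shift a g = trans (cong (_+ weightedSum a (g ∘ suc)) (sym (ℕₚ.*-identityˡ (g 1))))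
                              (sym (sum1to-shift a (λ k → weight a (pred k) · g k)))

weight-vanishes : ∀ {a k} → a < k → weight a k ≡ 0
weight-vanishes {k = k} a<k = cong (_· oddFact k) (k>n⇒nCk≡0 a<k)

weightedSum-step : ∀ p g →
  weightedSum (2 + p) g + 2 · suc p · (g 1 + weightedSum p (g ∘ suc))
  ≡ weightedSum (suc p) g + (2 · suc p + 1) · (g 1 + weightedSum (suc p) (g ∘ suc))
weightedSum-step p g = begin
  sum1to N F₁ + c · (g 1 + weightedSum p (g ∘ suc))   ≡⟨ cong (λ z → sum1to N F₁ + c · z) (weightedSum-shift p g) ⟩
  sum1to N F₁ + c · sum1to (suc p) F₂                  ≡⟨ cong (λ z → sum1to N F₁ + c · z)
                                                            (sym (sum1to-drop-last (suc p) F₂ (cong (_· g N) (weight-vanishes (ℕₚ.n<1+n p))))) ⟩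
  sum1to N F₁ + c · sum1to N F₂                        ≡⟨ sum1to-linear N c F₁ F₂ ⟩
  sum1to N (λ k → F₁ k + c · F₂ k)                     ≡⟨ sum1to-cong N termwise ⟩
  sum1to N (λ k → F₃ k + (c + 1) · F₄ k)               ≡⟨ sym (sum1to-linear N (c + 1) F₃ F₄) ⟩
  sum1to N F₃ + (c + 1) · sum1to N F₄                  ≡⟨ cong₂ (λ u v → u + (c + 1) · v)
                                                            (sum1to-drop-last (suc p) F₃ (cong (_· g N) (weight-vanishes (ℕₚ.n<1+n (suc p)))))
                                                            (sym (weightedSum-shift (suc p) g)) ⟩
  sum1to (suc p) F₃ + (c + 1) · (g 1 + weightedSum (suc p) (g ∘ suc)) ∎
  where
  N = 2 + p
  c = 2 · suc p
  F₁ F₂ F₃ F₄ : ℕ → ℕ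
  F₁ k = weight N k · g k
  F₂ k = weight p (pred k) · g k
  F₃ k = weight (suc p) k · g k
  F₄ k = weight (suc p) (pred k) · g k
  distrib : ∀ a b c g → a · g + c · (b · g) ≡ (a + c · b) · g
  distrib = solve-∀
  termwise : ∀ i → F₁ (suc i) + c · F₂ (suc i) ≡ F₃ (suc i) + (c + 1) · F₄ (suc i)
  termwise i = begin
    F₁ (suc i) + c · F₂ (suc i)                          ≡⟨ distrib (weight N (suc i)) (weight p i) c G ⟩
    (weight N (suc i) + c · weight p i) · G              ≡⟨ cong (_· G) (weight-step p i) ⟩
    (weight (suc p) (suc i) + (c + 1) · weight (suc p) i) · G
                                                         ≡⟨ sym (distrib (weight (suc p) (suc i)) (weight (suc p) i) (c + 1) G) ⟩
    F₃ (suc i) + (c + 1) · F₄ (suc i)                    ∎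
    where G = g (suc i)

length-∷ʳ : ∀ {A : Set} (xs : List A) x → length (xs ∷ʳ x) ≡ suc (length xs)
length-∷ʳ []       x = refl
length-∷ʳ (y ∷ xs) x = cong suc (length-∷ʳ xs x)

reverse-∷ʳ : ∀ {A : Set} (xs : List A) x → reverse (xs ∷ʳ x) ≡ x ∷ reverse xs
reverse-∷ʳ xs x = Listₚ.reverse-++ xs (x ∷ [])

length-dropZeros : ∀ l → length (dropZeros l) ≤ length l
length-dropZeros []          = z≤n
length-dropZeros (zero ∷ l)  = ℕₚ.m≤n⇒m≤1+n (length-dropZeros l)
length-dropZeros (suc x ∷ l) = s≤s (length-dropZeros l)

length-minusHat : ∀ l k → length (minusHat l k) ≤ length l
length-minusHat l k = ℕₚ.≤-trans (length-dropZeros (map (_∸ k) l)) (ℕₚ.≤-reflexive (Listₚ.length-map (_∸ k) l))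

dropZeros-++ : ∀ l l′ → dropZeros (l ++ l′) ≡ dropZeros l ++ dropZeros l′
dropZeros-++ []          l′ = refl
dropZeros-++ (zero ∷ l)  l′ = dropZeros-++ l l′
dropZeros-++ (suc x ∷ l) l′ = cong (suc x ∷_) (dropZeros-++ l l′)

reverse-dropZeros : ∀ l → reverse (dropZeros l) ≡ dropZeros (reverse l)
reverse-dropZeros [] = refl
reverse-dropZeros (x ∷ l) = begin
  reverse (dropZeros (x ∷ l))                            ≡⟨ cong reverse (dropZeros-++ (x ∷ []) l) ⟩
  reverse (dropZeros (x ∷ []) ++ dropZeros l)            ≡⟨ Listₚ.reverse-++ (dropZeros (x ∷ [])) (dropZeros l) ⟩
  reverse (dropZeros l) ++ reverse (dropZeros (x ∷ []))  ≡⟨ cong₂ _++_ (reverse-dropZeros l) (reverse-singleton x) ⟩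
  dropZeros (reverse l) ++ dropZeros (x ∷ [])            ≡⟨ sym (dropZeros-++ (reverse l) (x ∷ [])) ⟩
  dropZeros (reverse l ∷ʳ x)                             ≡⟨ cong dropZeros (sym (Listₚ.unfold-reverse x l)) ⟩
  dropZeros (reverse (x ∷ l))                            ∎
  where
  reverse-singleton : ∀ x → reverse (dropZeros (x ∷ [])) ≡ dropZeros (x ∷ [])
  reverse-singleton zero    = refl
  reverse-singleton (suc x) = refl

reverse-minusHat : ∀ l k → reverse (minusHat l k) ≡ minusHat (reverse l) k
reverse-minusHat l k = trans (reverse-dropZeros (map (_∸ k) l)) (cong dropZeros (sym (Listₚ.reverse-map (_∸ k) l)))

minusHat-dropZeros : ∀ l k → minusHat (dropZeros l) k ≡ minusHat l k
minusHat-dropZeros []          k = refl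
minusHat-dropZeros (zero ∷ l)  k rewrite ℕₚ.0∸n≡0 k = minusHat-dropZeros l k
minusHat-dropZeros (suc x ∷ l) k with suc x ∸ k
... | zero  = minusHat-dropZeros l k
... | suc y = cong (suc y ∷_) (minusHat-dropZeros l k)

minusHat-minusHat : ∀ l j k → minusHat (minusHat l j) k ≡ minusHat l (j + k)
minusHat-minusHat l j k = begin
  minusHat (dropZeros (map (_∸ j) l)) k    ≡⟨ minusHat-dropZeros (map (_∸ j) l) k ⟩
  dropZeros (map (_∸ k) (map (_∸ j) l))    ≡⟨ cong dropZeros (sym (Listₚ.map-∘ l)) ⟩
  dropZeros (map ((_∸ k) ∘ (_∸ j)) l)      ≡⟨ cong dropZeros (Listₚ.map-cong (λ x → ℕₚ.∸-+-assoc x j k) l) ⟩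
  dropZeros (map (_∸ (j + k)) l)           ∎

minusHat-∷ʳ : ∀ l x k → minusHat (l ∷ʳ x) k ≡ minusHat l k ++ dropZeros (x ∸ k ∷ [])
minusHat-∷ʳ l x k = trans (cong dropZeros (Listₚ.map-++ (_∸ k) l (x ∷ []))) (dropZeros-++ (map (_∸ k) l) (x ∸ k ∷ []))

fRev-fuel : ∀ a b l → length l ≤ suc a → length l ≤ suc b → fRev a l ≡ fRev b l
fRev-fuel a       b       []           _         _         = refl
fRev-fuel a       b       (x ∷ [])     _         _         = refl
fRev-fuel zero    b       (m ∷ x ∷ l)  (s≤s ())  _
fRev-fuel (suc a) zero    (m ∷ x ∷ l)  _         (s≤s ())
fRev-fuel (suc a) (suc b) (m ∷ x ∷ l)  (s≤s ha)  (s≤s hb) =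
  cong₂ _+_ (fRev-fuel a b (x ∷ l) ha hb)
            (sum1to-cong m λ k → cong (weight m (suc k) ·_)
              (fRev-fuel a b (minusHat (x ∷ l) (suc k))
                (ℕₚ.≤-trans (length-minusHat (x ∷ l) (suc k)) ha)
                (ℕₚ.≤-trans (length-minusHat (x ∷ l) (suc k)) hb)))

fRev-reverse : ∀ a l → length l ≤ suc a → fRev a (reverse l) ≡ f l
fRev-reverse a l h = fRev-fuel a (length l) (reverse l)
  (ℕₚ.≤-trans (ℕₚ.≤-reflexive (Listₚ.length-reverse l)) h)
  (ℕₚ.≤-trans (ℕₚ.≤-reflexive (Listₚ.length-reverse l)) (ℕₚ.n≤1+n (length l)))

f-∷ʳ : ∀ ν x m → f (ν ∷ʳ x ∷ʳ m) ≡ f (ν ∷ʳ x) + weightedSum m (λ k → f (minusHat (ν ∷ʳ x) k))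
f-∷ʳ ν x m = begin
  f (L ∷ʳ m)                                    ≡⟨ sym (fRev-reverse (suc ℓ) (L ∷ʳ m) |L∷ʳm|≤) ⟩
  fRev (suc ℓ) (reverse (L ∷ʳ m))               ≡⟨ cong (fRev (suc ℓ)) (trans (reverse-∷ʳ L m) (cong (m ∷_) revL)) ⟩
  fRev ℓ (x ∷ reverse ν)
    + sum1to m (λ k → weight m k · fRev ℓ (minusHat (x ∷ reverse ν) k))
                                                ≡⟨ cong₂ _+_ unfold-L (sum1to-cong m λ k → cong (weight m (suc k) ·_)
                                                                                                (unfold-minusHat (suc k))) ⟩
  f L + weightedSum m (λ k → f (minusHat L k))  ∎
  where
  L = ν ∷ʳ x
  ℓ = length ν
  |L|≡ : length L ≡ suc ℓ
  |L|≡ = length-∷ʳ ν x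
  |L∷ʳm|≤ : length (L ∷ʳ m) ≤ suc (suc ℓ)
  |L∷ʳm|≤ = ℕₚ.≤-reflexive (trans (length-∷ʳ L m) (cong suc |L|≡))
  revL : reverse L ≡ x ∷ reverse ν
  revL = reverse-∷ʳ ν x
  unfold-L : fRev ℓ (x ∷ reverse ν) ≡ f L
  unfold-L = trans (cong (fRev ℓ) (sym revL)) (fRev-reverse ℓ L (ℕₚ.≤-reflexive |L|≡))
  unfold-minusHat : ∀ k → fRev ℓ (minusHat (x ∷ reverse ν) k) ≡ f (minusHat L k)
  unfold-minusHat k = begin
    fRev ℓ (minusHat (x ∷ reverse ν) k)  ≡⟨ cong (λ l → fRev ℓ (minusHat l k)) (sym revL) ⟩
    fRev ℓ (minusHat (reverse L) k)      ≡⟨ cong (fRev ℓ) (sym (reverse-minusHat L k)) ⟩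
    fRev ℓ (reverse (minusHat L k))      ≡⟨ fRev-reverse ℓ (minusHat L k)
                                              (ℕₚ.≤-trans (length-minusHat L k) (ℕₚ.≤-reflexive |L|≡)) ⟩
    f (minusHat L k)                     ∎

-- The penultimate part suc (suc y) stays positive in the subtraction of 1̂, which is what
-- lets the recursion of f unfold again on the result.
f-minusHat-∷ʳ : ∀ ν y a → let L = ν ∷ʳ suc (suc y) in
  f (minusHat (L ∷ʳ suc a) 1) ≡ f (minusHat L 1) + weightedSum a (λ k → f (minusHat L (suc k)))
f-minusHat-∷ʳ ν y zero = begin
  f (minusHat (L ∷ʳ 1) 1)   ≡⟨ cong f (trans (minusHat-∷ʳ L 1 1) (Listₚ.++-identityʳ (minusHat L 1))) ⟩
  f (minusHat L 1)          ≡⟨ sym (ℕₚ.+-identityʳ _) ⟩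
  f (minusHat L 1) + 0      ∎
  where L = ν ∷ʳ suc (suc y)
f-minusHat-∷ʳ ν y (suc b) = begin
  f (minusHat (L ∷ʳ (2 + b)) 1)                              ≡⟨ cong f (minusHat-∷ʳ L (2 + b) 1) ⟩
  f (minusHat L 1 ∷ʳ suc b)                                  ≡⟨ cong (λ M → f (M ∷ʳ suc b)) M≡ ⟩
  f (minusHat ν 1 ∷ʳ suc y ∷ʳ suc b)                         ≡⟨ f-∷ʳ (minusHat ν 1) (suc y) (suc b) ⟩
  f (minusHat ν 1 ∷ʳ suc y)
    + weightedSum (suc b) (λ k → f (minusHat (minusHat ν 1 ∷ʳ suc y) k))
                                                             ≡⟨ cong (λ M → f M + weightedSum (suc b) (λ k → f (minusHat M k)))
                                                                     (sym M≡) ⟩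
  f (minusHat L 1) + weightedSum (suc b) (λ k → f (minusHat (minusHat L 1) k))
                                                             ≡⟨ cong (λ z → f (minusHat L 1) + z) (sum1to-cong (suc b) λ k →
                                                                  cong (λ M → weight (suc b) (suc k) · f M) (minusHat-minusHat L 1 (suc k))) ⟩
  f (minusHat L 1) + weightedSum (suc b) (λ k → f (minusHat L (suc k))) ∎
  where
  L = ν ∷ʳ suc (suc y)
  M≡ : minusHat L 1 ≡ minusHat ν 1 ∷ʳ suc y
  M≡ = minusHat-∷ʳ ν (suc (suc y)) 1

f-raise-step : ∀ ν y p → let L = ν ∷ʳ suc (suc y) in
  f (L ∷ʳ (2 + p)) + 2 · suc p · f (minusHat (L ∷ʳ suc p) 1)
  ≡ f (L ∷ʳ suc p) + (2 · suc p + 1) · f (minusHat (L ∷ʳ (2 + p)) 1)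
f-raise-step ν y p = begin
  f (L ∷ʳ (2 + p)) + c · f (minusHat (L ∷ʳ suc p) 1)     ≡⟨ cong₂ (λ u v → u + c · v) (f-∷ʳ ν (2 + y) (2 + p)) (f-minusHat-∷ʳ ν y p) ⟩
  (f L + weightedSum (2 + p) g) + c · (g 1 + weightedSum p (g ∘ suc))
                                                          ≡⟨ ℕₚ.+-assoc (f L) _ _ ⟩
  f L + (weightedSum (2 + p) g + c · (g 1 + weightedSum p (g ∘ suc)))
                                                          ≡⟨ cong (λ z → f L + z) (weightedSum-step p g) ⟩
  f L + (weightedSum (suc p) g + (c + 1) · (g 1 + weightedSum (suc p) (g ∘ suc)))
                                                          ≡⟨ sym (ℕₚ.+-assoc (f L) _ _) ⟩
  (f L + weightedSum (suc p) g) + (c + 1) · (g 1 + weightedSum (suc p) (g ∘ suc))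
                                                          ≡⟨ sym (cong₂ (λ u v → u + (c + 1) · v)
                                                                   (f-∷ʳ ν (2 + y) (suc p)) (f-minusHat-∷ʳ ν y (suc p))) ⟩
  f (L ∷ʳ suc p) + (c + 1) · f (minusHat (L ∷ʳ (2 + p)) 1) ∎
  where
  L = ν ∷ʳ suc (suc y)
  c = 2 · suc p
  g : ℕ → ℕ
  g k = f (minusHat L k)

m+q≡n+p⇒m-n≡p-q : ∀ m n p q → m + q ≡ n + p → + m - + n ≡ + p - + q
m+q≡n+p⇒m-n≡p-q m n p q eq = begin
  + m - + n          ≡⟨ ℤₚ.m-n≡m⊖n m n ⟩
  m ⊖ n              ≡⟨ sym (ℤₚ.+-cancelˡ-⊖ q m n) ⟩
  (q + m) ⊖ (q + n)  ≡⟨ cong₂ _⊖_ (trans (ℕₚ.+-comm q m) eq) (ℕₚ.+-comm q n) ⟩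
  (n + p) ⊖ (n + q)  ≡⟨ ℤₚ.+-cancelˡ-⊖ n p q ⟩
  p ⊖ q              ≡⟨ sym (ℤₚ.m-n≡m⊖n p q) ⟩
  + p - + q          ∎

f-raise-last : ∀ ν {x m} → 0 < m → m < x →
  + f (ν ∷ʳ x ∷ʳ suc m) - + f (ν ∷ʳ x ∷ʳ m)
  ≡ + (2 · m + 1) * + f (minusHat (ν ∷ʳ x ∷ʳ suc m) 1) - + (2 · m) * + f (minusHat (ν ∷ʳ x ∷ʳ m) 1)
f-raise-last ν {suc (suc y)} {suc p} _ _ = begin
  + f (L ∷ʳ (2 + p)) - + f (L ∷ʳ suc p)          ≡⟨ m+q≡n+p⇒m-n≡p-q (f (L ∷ʳ (2 + p))) (f (L ∷ʳ suc p)) (c′ · X) (c · Y)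
                                                    (f-raise-step ν y p) ⟩
  + (c′ · X) - + (c · Y)                        ≡⟨ cong₂ _-_ (ℤₚ.pos-* c′ X) (ℤₚ.pos-* c Y) ⟩
  + c′ * + X - + c * + Y                        ∎
  where
  L = ν ∷ʳ suc (suc y)
  c = 2 · suc p
  c′ = c + 1
  X = f (minusHat (L ∷ʳ (2 + p)) 1)
  Y = f (minusHat (L ∷ʳ suc p) 1)
f-raise-last ν {suc zero} {suc p} _ (s≤s ())

part-++-∷ : ∀ xs y ys → part (xs ++ y ∷ ys) (suc (length xs)) ≡ y
part-++-∷ []       y ys = refl
part-++-∷ (x ∷ xs) y ys = part-++-∷ xs y ys

part-last : ∀ xs y → part (xs ∷ʳ y) (length (xs ∷ʳ y)) ≡ y
part-last xs y = trans (cong (part (xs ∷ʳ y)) (length-∷ʳ xs y)) (part-++-∷ xs y [])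

part-penultimate : ∀ xs x y → part (xs ∷ʳ x ∷ʳ y) (length (xs ∷ʳ x ∷ʳ y) ∸ 1) ≡ x
part-penultimate xs x y = begin
  part (xs ∷ʳ x ∷ʳ y) (length (xs ∷ʳ x ∷ʳ y) ∸ 1)  ≡⟨ cong₂ part (Listₚ.++-assoc xs (x ∷ []) (y ∷ []))
                                                              (trans (cong (_∸ 1) (length-∷ʳ (xs ∷ʳ x) y)) (length-∷ʳ xs x)) ⟩
  part (xs ++ x ∷ y ∷ []) (suc (length xs))        ≡⟨ part-++-∷ xs x (y ∷ []) ⟩
  x                                                ∎

raise-++-∷ : ∀ xs y ys → raise (suc (length xs)) (xs ++ y ∷ ys) ≡ xs ++ suc y ∷ ys
raise-++-∷ []       y ys = refl
raise-++-∷ (x ∷ xs) y ys = cong (x ∷_) (raise-++-∷ xs y ys)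

raise-last : ∀ xs y → raise (length (xs ∷ʳ y)) (xs ∷ʳ y) ≡ xs ∷ʳ suc y
raise-last xs y = trans (cong (λ i → raise i (xs ∷ʳ y)) (length-∷ʳ xs y)) (raise-++-∷ xs y [])

split-last-two : ∀ {A : Set} (μ : List A) → 2 ≤ length μ → ∃[ ν ] ∃[ x ] ∃[ m ] μ ≡ ν ∷ʳ x ∷ʳ m
split-last-two μ h with initLast μ
split-last-two .[] () | []
split-last-two .(ν ∷ʳ m) h | ν ∷ʳ′ m with initLast ν
split-last-two .([] ∷ʳ m) (s≤s ()) | .[] ∷ʳ′ m | []
split-last-two .(ν ∷ʳ x ∷ʳ m) h | .(ν ∷ʳ x) ∷ʳ′ m | ν ∷ʳ′ x = ν , x , m , refl

lemma2p2 : (n : ℕ) (μ : List ℕ) → μ ⊢ n → 2 ≤ length μ →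
    part μ (length μ ∸ 1) > part μ (length μ) →
    (+ f (raise (length μ) μ)) - (+ f μ)
      ≡ (+ (2 Data.Nat.* part μ (length μ) Data.Nat.+ 1)) * (+ f (minusHat (raise (length μ) μ) 1))
        - (+ (2 Data.Nat.* part μ (length μ))) * (+ f (minusHat μ 1))
lemma2p2 n μ ((_ , μ>0) , _) 2≤|μ| μₛ<μₛ₋₁ with split-last-two μ 2≤|μ|
... | ν , x , m , refl
  rewrite raise-last (ν ∷ʳ x) m | part-last (ν ∷ʳ x) m =
  f-raise-last ν (proj₂ (∷ʳ⁻ μ>0)) (subst (m <_) (part-penultimate ν x m) μₛ<μₛ₋₁)
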